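{- Let a disconnected graph $G$ be factored into a connected graph $H$ and a graph $K$ with no isolated vertex. Then $H$ and $K$ are both bipartite.
   Context: All graphs are finite and simple. A graph $G$ is factored into graphs $H$ and $K$ (all on $n$ vertices) if there exist adjacency matrices $A,B,C$ of $G,H,K$ respectively (symmetric $n\times n$ $(0,1)$-matrices with zero diagonal, for some vertex orderings) with $A=BC$; the three graphs are then regarded as having the common vertex set $\{1,\dots,n\}$. -}

module Defs where

open import Data.Nat using (ℕ; zero; suc; _+_; _*_)
open import Data.Fin using (Fin; zero; suc)
open import Data.Bool using (Bool)
open import Data.Product using (Σ; _×_; ∃; ∃-syntax)
open import Data.Sum using (_⊎_)
open import Relation.Binary.PropositionalEquality using (_≡_; _≢_)
open import Relation.Nullary using (¬_)

Matrix : ℕ → Set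
Matrix n = Fin n → Fin n → ℕ

sumFin : ∀ {n} → (Fin n → ℕ) → ℕ
sumFin {zero}  f = 0
sumFin {suc n} f = f zero + sumFin (λ i → f (suc i))

_⊗_ : ∀ {n} → Matrix n → Matrix n → Matrix n
(B ⊗ C) i j = sumFin (λ k → B i k * C k j)

record IsAdjacencyMatrix {n : ℕ} (A : Matrix n) : Set where
  field
    zero-one  : ∀ i j → A i j ≡ 0 ⊎ A i j ≡ 1
    symmetric : ∀ i j → A i j ≡ A j i
    zero-diag : ∀ i → A i i ≡ 0

Adj : ∀ {n} → Matrix n → Fin n → Fin n → Set
Adj A i j = A i j ≡ 1

data Reachable {n : ℕ} (A : Matrix n) : Fin n → Fin n → Set where
  here : ∀ {i} → Reachable A i i
  step : ∀ {i j k} → Adj A i j → Reachable A j k → Reachable A i k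

Connected : ∀ {n} → Matrix n → Set
Connected {n} A = ∀ (i j : Fin n) → Reachable A i j

Disconnected : ∀ {n} → Matrix n → Set
Disconnected A = ¬ Connected A

NoIsolatedVertex : ∀ {n} → Matrix n → Set
NoIsolatedVertex {n} A = ∀ (i : Fin n) → ∃[ j ] Adj A i j

Bipartite : ∀ {n} → Matrix n → Set
Bipartite {n} A = Σ (Fin n → Bool) λ c → ∀ (i j : Fin n) → Adj A i j → c i ≢ c j

{-# OPTIONS --safe #-}
module Submission where

-- Write G, H, K for the graphs of A, B, C. Two vertices with a common
-- H-neighbour u are joined in G through any K-neighbour of u. Hence an H-edge
-- inside a component of G would spread along the connected graph H and make G
-- connected: H-edges, and then also K-edges (a K-edge u m yields the G-edge
-- w m for every H-neighbour w of u), join different components of G. Starting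
-- from the ends r, s of one H-edge, every vertex is G-reachable from r or from
-- s, so colouring a vertex by the one it is reachable from 2-colours H and K.

open import Defs
open import Level using (Level)
open import Data.Nat using (ℕ; zero; suc; _*_; _≤_)
open import Data.Nat.Properties using (≤-trans; m≤m+n; m≤n+m; 0≢1+n; module ≤-Reasoning)
open import Data.Fin using (Fin; zero; suc)
open import Data.Bool using (Bool; true; false)
open import Data.Product using (_×_; _,_; proj₁; proj₂; ∃-syntax)
open import Data.Sum using (_⊎_; inj₁; inj₂; [_,_])
open import Data.Empty using (⊥-elim)
open import Function using (_∘_; id)
open import Relation.Binary.Core using (Rel)
open import Relation.Binary.Definitions using (Symmetric; Transitive)
open import Relation.Binary.Structures using (IsEquivalence)
open import Relation.Binary.PropositionalEquality as ≡ using (_≡_; _≢_; refl; cong₂; subst)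
open import Relation.Nullary using (¬_)
open import Relation.Nullary.Negation using (contradiction)

private
  variable
    ℓ : Level
    n : ℕ
    i j k r s : Fin n

term≤sumFin : (f : Fin n → ℕ) (k : Fin n) → f k ≤ sumFin f
term≤sumFin f zero    = m≤m+n (f zero) _
term≤sumFin f (suc k) = ≤-trans (term≤sumFin (f ∘ suc) k) (m≤n+m _ (f zero))

factor-edges⇒product-edge : {A B C : Matrix n} →
                            (∀ i j → A i j ≡ 0 ⊎ A i j ≡ 1) →
                            (∀ i j → A i j ≡ (B ⊗ C) i j) →
                            Adj B i j → Adj C j k → Adj A i k
factor-edges⇒product-edge {i = i} {j} {k} {A} {B} {C} A-zero-one A≡BC ij jk =
  [ (λ A-ik≡0 → contradiction (subst (1 ≤_) A-ik≡0 1≤A-ik) λ ()) , id ] (A-zero-one i k)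
  where
  open ≤-Reasoning
  1≤A-ik : 1 ≤ A i k
  1≤A-ik = begin
    1              ≡⟨ ≡.sym (cong₂ _*_ ij jk) ⟩
    B i j * C j k  ≤⟨ term≤sumFin (λ l → B i l * C l k) j ⟩
    (B ⊗ C) i k    ≡⟨ ≡.sym (A≡BC i k) ⟩
    A i k          ∎

adj-symmetric : {M : Matrix n} → IsAdjacencyMatrix M → Symmetric (Adj M)
adj-symmetric M-adj {i} {j} e = ≡.trans (IsAdjacencyMatrix.symmetric M-adj j i) e

adj⇒≢ : {M : Matrix n} → IsAdjacencyMatrix M → Adj M i j → i ≢ j
adj⇒≢ M-adj e refl = 0≢1+n (≡.trans (≡.sym (IsAdjacencyMatrix.zero-diag M-adj _)) e)

reachable-trans : {M : Matrix n} → Transitive (Reachable M)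
reachable-trans here       q = q
reachable-trans (step e p) q = step e (reachable-trans p q)

reachable-sym : {M : Matrix n} → Symmetric (Adj M) → Symmetric (Reachable M)
reachable-sym adj-sym here       = here
reachable-sym adj-sym (step e p) = reachable-trans (reachable-sym adj-sym p) (step (adj-sym e) here)

reachable-isEquivalence : {M : Matrix n} → Symmetric (Adj M) → IsEquivalence (Reachable M)
reachable-isEquivalence adj-sym = record
  { refl  = here
  ; sym   = reachable-sym adj-sym
  ; trans = reachable-trans
  }

reachable-≢⇒has-neighbour : {M : Matrix n} → Reachable M i j → i ≢ j → ∃[ k ] Adj M i k
reachable-≢⇒has-neighbour here       i≢i = contradiction refl i≢i
reachable-≢⇒has-neighbour (step e _) _   = _ , e

disconnected⇒nonempty : {M : Matrix n} → Disconnected M → Fin n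
disconnected⇒nonempty {zero}  disconnected = ⊥-elim (disconnected λ ())
disconnected⇒nonempty {suc n} _            = zero

module TwoClasses {_~_ : Rel (Fin n) ℓ} (~-equiv : IsEquivalence _~_) where
  private module ~ = IsEquivalence ~-equiv

  side : r ~ i ⊎ s ~ i → Bool
  side (inj₁ _) = true
  side (inj₂ _) = false

  same-side⇒~ : (p : r ~ i ⊎ s ~ i) (q : r ~ j ⊎ s ~ j) → side p ≡ side q → i ~ j
  same-side⇒~ (inj₁ ri) (inj₁ rj) _ = ~.trans (~.sym ri) rj
  same-side⇒~ (inj₂ si) (inj₂ sj) _ = ~.trans (~.sym si) sj
  same-side⇒~ (inj₁ _)  (inj₂ _)  ()
  same-side⇒~ (inj₂ _)  (inj₁ _)  ()

  two-classes⇒bipartite : (∀ v → r ~ v ⊎ s ~ v) → {M : Matrix n} →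
                          (∀ {i j} → Adj M i j → ¬ i ~ j) → Bipartite M
  two-classes⇒bipartite cover crosses =
    side ∘ cover , λ i j e same → crosses e (same-side⇒~ (cover i) (cover j) same)

module CommonNeighbourClasses
  {B : Matrix n} (B-sym : Symmetric (Adj B))
  {_~_ : Rel (Fin n) ℓ} (~-equiv : IsEquivalence _~_)
  (common-neighbour⇒~ : ∀ {u x y} → Adj B u x → Adj B u y → x ~ y)
  (B-connected : Connected B)
  where
  private module ~ = IsEquivalence ~-equiv

  -- The next edge i l of the walk lies inside a class too, as j and l share the neighbour i.
  reachable-from-edge-within-class : Adj B i j → i ~ j → Reachable B i k → i ~ k
  reachable-from-edge-within-class _  _   here        = ~.refl
  reachable-from-edge-within-class {i = i} ij i~j (step {j = l} il w) =
    ~.trans i~l (reachable-from-edge-within-class (B-sym il) (~.sym i~l) w)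
    where
    i~l : i ~ l
    i~l = ~.trans i~j (common-neighbour⇒~ ij il)

  reachable⇒~-edge-end : Reachable B i k → Adj B i j → i ~ k ⊎ j ~ k
  reachable⇒~-edge-end here          _  = inj₁ ~.refl
  reachable⇒~-edge-end (step il w) ij with reachable⇒~-edge-end w (B-sym il)
  ... | inj₁ l~k = inj₂ (~.trans (common-neighbour⇒~ ij il) l~k)
  ... | inj₂ i~k = inj₁ i~k

  edge⇒¬~ : ¬ (∀ u v → u ~ v) → Adj B i j → ¬ i ~ j
  edge⇒¬~ {i = i} not-all ij i~j = not-all λ u v →
    ~.trans (~.sym (from-i u)) (from-i v)
    where
    from-i : ∀ v → i ~ v
    from-i v = reachable-from-edge-within-class ij i~j (B-connected _ v)

  edge⇒two-classes : Adj B r s → ∀ v → r ~ v ⊎ s ~ v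
  edge⇒two-classes rs v = reachable⇒~-edge-end (B-connected _ v) rs

module Factorisation
  {A B C : Matrix n}
  (A-adj : IsAdjacencyMatrix A) (B-adj : IsAdjacencyMatrix B) (C-adj : IsAdjacencyMatrix C)
  (A≡BC : ∀ i j → A i j ≡ (B ⊗ C) i j)
  (B-connected : Connected B) (C-no-isolated : NoIsolatedVertex C)
  where

  private
    A-sym : Symmetric (Adj A)
    A-sym = adj-symmetric A-adj
    B-sym : Symmetric (Adj B)
    B-sym = adj-symmetric B-adj
    C-sym : Symmetric (Adj C)
    C-sym = adj-symmetric C-adj

  product-edge : Adj B i j → Adj C j k → Adj A i k
  product-edge = factor-edges⇒product-edge {B = B} {C} (IsAdjacencyMatrix.zero-one A-adj) A≡BC

  C-edge⇒B-neighbour : Adj C i j → ∃[ k ] Adj B i k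
  C-edge⇒B-neighbour ij = reachable-≢⇒has-neighbour (B-connected _ _) (adj⇒≢ C-adj ij)

  B-edge : (r : Fin n) → ∃[ s ] Adj B r s
  B-edge r with C-no-isolated r
  ... | _ , rt = C-edge⇒B-neighbour rt

  common-B-neighbour⇒A-reachable : ∀ {u x y} → Adj B u x → Adj B u y → Reachable A x y
  common-B-neighbour⇒A-reachable ux uy with C-no-isolated _
  ... | _ , ul = step (product-edge (B-sym ux) ul) (step (A-sym (product-edge (B-sym uy) ul)) here)

  open CommonNeighbourClasses B-sym (reachable-isEquivalence A-sym)
         common-B-neighbour⇒A-reachable B-connected public

  C-edge⇒¬~ : Disconnected A → Adj C i j → ¬ Reachable A i j
  C-edge⇒¬~ A-disconnected ij i~j with C-edge⇒B-neighbour (C-sym ij)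
  ... | _ , jk = edge⇒¬~ A-disconnected jk
                   (reachable-sym A-sym (step (product-edge (B-sym jk) (C-sym ij)) i~j))

corollary6p8 : ∀ (n : ℕ) (A B C : Matrix n)
    → IsAdjacencyMatrix A → IsAdjacencyMatrix B → IsAdjacencyMatrix C
    → (∀ i j → A i j ≡ (B ⊗ C) i j)
    → Disconnected A → Connected B → NoIsolatedVertex C
    → Bipartite B × Bipartite C
corollary6p8 n A B C A-adj B-adj C-adj A≡BC A-disconnected B-connected C-no-isolated =
  two-classes⇒bipartite cover (edge⇒¬~ A-disconnected) ,
  two-classes⇒bipartite cover (C-edge⇒¬~ A-disconnected)
  where
  open Factorisation A-adj B-adj C-adj A≡BC B-connected C-no-isolated
  open TwoClasses (reachable-isEquivalence (adj-symmetric A-adj))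

  root : Fin n
  root = disconnected⇒nonempty A-disconnected

  cover : ∀ v → Reachable A root v ⊎ Reachable A (proj₁ (B-edge root)) v
  cover = edge⇒two-classes (proj₂ (B-edge root))
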